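{- Let $X$ be a finite set with $|X|\geq 4$, let $M$ be a set, and let $\delta:\binom{X}{3}\to M$ be a three-way symbolic map satisfying: (M1) for all $\{x,y,z,u\}\in\binom{X}{4}$, either $\delta(x,y,z)=\delta(x,y,u)=\delta(x,z,u)=\delta(y,z,u)$, or two of these four values are equal and the remaining two are equal; and (M2) there do not exist pairwise distinct $x,y,z,u,v\in X$ with $\delta(v,x,y)=\delta(v,y,z)=\delta(v,z,u)\neq\delta(v,z,x)=\delta(v,x,u)=\delta(v,u,y)$. Then for every $r\in X$, the map $\delta_r:\binom{X\setminus\{r\}}{2}\to M$, $\delta_r(x,y)=\delta(x,y,r)$, is a symbolic ultrametric.
   Context: A (two-way) symbolic ultrametric on a set $Z$ is a map $D:\binom{Z}{2}\to M$ satisfying (U1): for all distinct $x,y,z\in Z$, at least two of $D(x,y),D(y,z),D(x,z)$ are equal; and (U2): there are no pairwise distinct $x,y,z,u\in Z$ with $D(x,y)=D(y,z)=D(z,u)\neq D(z,x)=D(x,u)=D(u,y)$. -}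

module Defs where

open import Level using (Level)
open import Data.Nat using (ℕ; _≥_)
open import Data.Fin using (Fin)
open import Data.Product using (_×_)
open import Data.Sum using (_⊎_)
open import Relation.Nullary using (¬_)
open import Relation.Binary.PropositionalEquality using (_≡_; _≢_)

-- Unordered pairs/triples are represented by ordered tuples of pairwise distinct
-- elements, together with invariance under permutation of arguments.

record ThreeWayMap {m : Level} (n : ℕ) (M : Set m) : Set m where
  field
    δ    : Fin n → Fin n → Fin n → M
    swap₁₂ : ∀ x y z → δ x y z ≡ δ y x z
    swap₂₃ : ∀ x y z → δ x y z ≡ δ x z y

module _ {m : Level} {n : ℕ} {M : Set m} (T : ThreeWayMap n M) where
  open ThreeWayMap T

  Distinct4 : Fin n → Fin n → Fin n → Fin n → Set
  Distinct4 x y z u = x ≢ y × x ≢ z × x ≢ u × y ≢ z × y ≢ u × z ≢ u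

  M1 : Set m
  M1 = ∀ x y z u → Distinct4 x y z u →
       let a = δ x y z ; b = δ x y u ; c = δ x z u ; d = δ y z u in
       (a ≡ b × b ≡ c × c ≡ d)
       ⊎ ((a ≡ b × c ≡ d) ⊎ ((a ≡ c × b ≡ d) ⊎ (a ≡ d × b ≡ c)))

  M2 : Set m
  M2 = ∀ x y z u v → Distinct4 x y z u →
       v ≢ x → v ≢ y → v ≢ z → v ≢ u →
       ¬ (δ v x y ≡ δ v y z × δ v y z ≡ δ v z u × δ v z u ≢ δ v z x
          × δ v z x ≡ δ v x u × δ v x u ≡ δ v u y)

record SymbolicUltrametric {m : Level} {n : ℕ} {M : Set m}
       (Z : Fin n → Set) (D : Fin n → Fin n → M) : Set m where
  field
    symmetric : ∀ x y → Z x → Z y → x ≢ y → D x y ≡ D y x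
    U1 : ∀ x y z → Z x → Z y → Z z → x ≢ y → x ≢ z → y ≢ z →
         (D x y ≡ D y z) ⊎ ((D y z ≡ D x z) ⊎ (D x y ≡ D x z))
    U2 : ∀ x y z u → Z x → Z y → Z z → Z u →
         x ≢ y → x ≢ z → x ≢ u → y ≢ z → y ≢ u → z ≢ u →
         ¬ (D x y ≡ D y z × D y z ≡ D z u × D z u ≢ D z x
            × D z x ≡ D x u × D x u ≡ D u y)

-- The value δ(x,y,r) is δ_r(x,y), so (U1) for δ_r is (M1) read on the quadruple
-- {x,y,z,r}, and since δ(x,y,r) = δ(r,x,y), (U2) for δ_r is exactly (M2) with v = r.
module Submission where

open import Defs
open import Level using (Level)
open import Data.Nat using (ℕ; _≥_)
open import Data.Fin using (Fin)
open import Data.Product using (_×_; _,_)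
open import Data.Sum using (_⊎_; inj₁; inj₂)
open import Relation.Nullary using (¬_)
open import Relation.Binary.PropositionalEquality
  using (_≡_; _≢_; sym; trans; ≢-sym; module ≡-Reasoning)

module _ {m : Level} {n : ℕ} {M : Set m} (T : ThreeWayMap n M) where
  open ThreeWayMap T

  δ-rotate : ∀ x y z → δ x y z ≡ δ z x y
  δ-rotate x y z = trans (swap₂₃ x y z) (swap₁₂ x z y)

  δ-rotate-≡ : ∀ {x y z w v} → δ x y v ≡ δ z w v → δ v x y ≡ δ v z w
  δ-rotate-≡ {x} {y} {z} {w} {v} eq = begin
    δ v x y  ≡⟨ δ-rotate x y v ⟨
    δ x y v  ≡⟨ eq ⟩
    δ z w v  ≡⟨ δ-rotate z w v ⟩
    δ v z w  ∎
    where open ≡-Reasoning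

  δ-rotate-≢ : ∀ {x y z w v} → δ x y v ≢ δ z w v → δ v x y ≢ δ v z w
  δ-rotate-≢ {x} {y} {z} {w} {v} neq eq =
    neq (trans (δ-rotate x y v) (trans eq (sym (δ-rotate z w v))))

  M1⇒two-of-three-equal : M1 T → ∀ x y z u → Distinct4 T x y z u →
    (δ x y u ≡ δ y z u) ⊎ (δ y z u ≡ δ x z u) ⊎ (δ x y u ≡ δ x z u)
  M1⇒two-of-three-equal m1 x y z u d with m1 x y z u d
  ... | inj₁ (_ , b≡c , _)           = inj₂ (inj₂ b≡c)
  ... | inj₂ (inj₁ (_ , c≡d))        = inj₂ (inj₁ (sym c≡d))
  ... | inj₂ (inj₂ (inj₁ (_ , b≡d))) = inj₁ b≡d
  ... | inj₂ (inj₂ (inj₂ (_ , b≡c))) = inj₂ (inj₂ b≡c)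

  M2⇒no-link-pattern : M2 T → ∀ x y z u v → Distinct4 T x y z u →
    v ≢ x → v ≢ y → v ≢ z → v ≢ u →
    ¬ (δ x y v ≡ δ y z v × δ y z v ≡ δ z u v × δ z u v ≢ δ z x v
       × δ z x v ≡ δ x u v × δ x u v ≡ δ u y v)
  M2⇒no-link-pattern m2 x y z u v d vx vy vz vu (p₁ , p₂ , p₃ , p₄ , p₅) =
    m2 x y z u v d vx vy vz vu
      (δ-rotate-≡ p₁ , δ-rotate-≡ p₂ , δ-rotate-≢ p₃ , δ-rotate-≡ p₄ , δ-rotate-≡ p₅)

lemma5 : {m : Level} (n : ℕ) → n ≥ 4 → (M : Set m) (T : ThreeWayMap n M) →
    M1 T → M2 T → (r : Fin n) →
    SymbolicUltrametric (λ x → x ≢ r) (λ x y → ThreeWayMap.δ T x y r)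
lemma5 n _ M T m1 m2 r = record
  { symmetric = λ x y _ _ _ → swap₁₂ x y r
  ; U1 = λ x y z xr yr zr xy xz yz →
      M1⇒two-of-three-equal T m1 x y z r (xy , xz , xr , yz , yr , zr)
  ; U2 = λ x y z u xr yr zr ur xy xz xu yz yu zu →
      M2⇒no-link-pattern T m2 x y z u r (xy , xz , xu , yz , yu , zu)
        (≢-sym xr) (≢-sym yr) (≢-sym zr) (≢-sym ur)
  }
  where open ThreeWayMap T
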